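{- There are $W(*)\subseteq\omega$ and, for each $\eta\in{}^\omega 2$, sets $W_\eta\subseteq\omega$ and $U_\eta\subseteq{}^{\omega>}2$ such that for all $\eta\in{}^\omega2$: (A) $W(*)$ and $W_\eta$ are infinite subsets of $\omega$; (B) $U_\eta$ is a perfect tree: $U_\eta$ is closed under initial segments, $\langle\rangle\in U_\eta$, and for every $\rho\in U_\eta$ there is $\nu\in U_\eta$ with $\rho\trianglelefteq\nu$ and $\nu^\frown\langle0\rangle,\nu^\frown\langle1\rangle\in U_\eta$; (C) if $\rho,\nu\in U_\eta$, $\rho\ne\nu$ and $\mathrm{lg}(\rho)=\mathrm{lg}(\nu)$, then $\mathrm{lg}(\rho\cap\nu)\in W_\eta$; (D) for all $\eta_1\ne\eta_2$ in ${}^\omega2$ and all $\rho\in U_{\eta_1}$, $\nu\in U_{\eta_2}$, at least one of the following holds: (a) $\mathrm{lg}(\rho\cap\nu)\in W_{\eta_1}\cap W_{\eta_2}$; (b) $\mathrm{lg}(\rho\cap\nu)\in W(*)$ and for every $\ell<\mathrm{lg}(\rho\cap\nu)$, $\ell\in W_{\eta_1}\iff\ell\in W_{\eta_2}$; (c) $\rho\trianglelefteq\nu$ or $\nu\triangleleft\rho$; (E) $W(*)\cap W_\eta=\emptyset$; (F) for distinct $\eta,\nu\in{}^\omega2$: (a) $W_\eta\cap W_\nu$ is finite, in fact an initial segment of both $W_\eta$ and $W_\nu$; (b) if $\ell\in W(*)$ is above (every element of) $W_\eta\cap W_\nu$, then $U_\eta\cap U_\nu$ is finite, is contained in ${}^{\ell'>}2$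 whenever $\ell<\ell'\in W_\eta\cup W_\nu$, and has no splitting at level $\ge\ell$, i.e. there is no $\rho\in{}^{\omega>}2$ with $\mathrm{lg}(\rho)\ge\ell$ and $\{\rho^\frown\langle0\rangle,\rho^\frown\langle1\rangle\}\subseteq U_\eta\cap U_\nu$; (c) if $\ell\in W(*)$ and $\ell<\sup(W_\eta\cap W_\nu)$, then $U_\eta\cap{}^{\ell\ge}2=U_\nu\cap{}^{\ell\ge}2$.
   Context: ${}^{\omega>}2$ is the set of finite 0-1 sequences and ${}^{\ell\ge}2$ the set of 0-1 sequences of length $\le\ell$; $\trianglelefteq$ ($\triangleleft$) denotes being a (proper) initial segment. For sequences $\rho,\nu$, $\rho\cap\nu$ denotes their largest common initial segment, so $\mathrm{lg}(\rho\cap\nu)=\max\{n:\rho\restriction n=\nu\restriction n\}$. -}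

module Defs where

open import Data.Nat using (ℕ; zero; suc; _<_; _≤_)
open import Data.Bool using (Bool; true; false; _≟_)
open import Data.List using (List; []; _∷_; _++_; [_]; length)
open import Data.List.Membership.Propositional using (_∈_)
open import Data.Product using (Σ; ∃; _×_; _,_)
open import Data.Sum using (_⊎_)
open import Data.Empty using (⊥)
open import Relation.Nullary using (¬_; yes; no)
open import Relation.Binary.PropositionalEquality using (_≡_; _≢_)

Seqω : Set
Seqω = ℕ → Bool

Seq : Set
Seq = List Bool

Subℕ : Set₁
Subℕ = ℕ → Set

SubSeq : Set₁
SubSeq = Seq → Set

_≠ω_ : Seqω → Seqω → Set
η ≠ω ν = ∃ λ n → η n ≢ ν n

_⊴_ : Seq → Seq → Set
ρ ⊴ ν = ∃ λ τ → ρ ++ τ ≡ ν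

_◁_ : Seq → Seq → Set
ρ ◁ ν = (ρ ⊴ ν) × (length ρ < length ν)

lgMeet : Seq → Seq → ℕ
lgMeet [] _ = zero
lgMeet (_ ∷ _) [] = zero
lgMeet (a ∷ ρ) (b ∷ ν) with a ≟ b
... | yes _ = suc (lgMeet ρ ν)
... | no _ = zero

_⌢_ : Seq → Bool → Seq
ν ⌢ b = ν ++ [ b ]

Infinite : Subℕ → Set
Infinite W = ∀ n → ∃ λ m → n ≤ m × W m

FiniteℕSet : Subℕ → Set
FiniteℕSet W = ∃ λ b → ∀ m → W m → m < b

FiniteSeqSet : SubSeq → Set
FiniteSeqSet U = ∃ λ (L : List Seq) → ∀ ρ → U ρ → ρ ∈ L

_∩ₙ_ : Subℕ → Subℕ → Subℕ
(A ∩ₙ B) n = A n × B n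

_∩ₛ_ : SubSeq → SubSeq → SubSeq
(A ∩ₛ B) ρ = A ρ × B ρ

InitialSegmentOf : Subℕ → Subℕ → Set
InitialSegmentOf A B = (∀ n → A n → B n) × (∀ m n → B m → m < n → A n → A m)

PerfectTree : SubSeq → Set
PerfectTree U =
  (∀ ρ ν → U ν → ρ ⊴ ν → U ρ)
  × U []
  × (∀ ρ → U ρ → ∃ λ ν → ρ ⊴ ν × U (ν ⌢ false) × U (ν ⌢ true))

ClauseA : Subℕ → (Seqω → Subℕ) → Seqω → Set
ClauseA W* W η = Infinite W* × Infinite (W η)

ClauseC : (Seqω → Subℕ) → (Seqω → SubSeq) → Seqω → Set
ClauseC W U η = ∀ ρ ν → U η ρ → U η ν → ρ ≢ ν → length ρ ≡ length ν → W η (lgMeet ρ ν)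

ClauseD : Subℕ → (Seqω → Subℕ) → (Seqω → SubSeq) → Set
ClauseD W* W U = ∀ η₁ η₂ → η₁ ≠ω η₂ → ∀ ρ ν → U η₁ ρ → U η₂ ν →
    (W η₁ (lgMeet ρ ν) × W η₂ (lgMeet ρ ν))
  ⊎ (W* (lgMeet ρ ν) × (∀ ℓ → ℓ < lgMeet ρ ν → (W η₁ ℓ → W η₂ ℓ) × (W η₂ ℓ → W η₁ ℓ)))
  ⊎ (ρ ⊴ ν ⊎ ν ◁ ρ)

ClauseE : Subℕ → (Seqω → Subℕ) → Seqω → Set
ClauseE W* W η = ∀ n → W* n → W η n → ⊥

ClauseFa : (Seqω → Subℕ) → Seqω → Seqω → Set
ClauseFa W η ν =
  FiniteℕSet (W η ∩ₙ W ν)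
  × InitialSegmentOf (W η ∩ₙ W ν) (W η)
  × InitialSegmentOf (W η ∩ₙ W ν) (W ν)

ClauseFb : Subℕ → (Seqω → Subℕ) → (Seqω → SubSeq) → Seqω → Seqω → Set
ClauseFb W* W U η ν = ∀ ℓ → W* ℓ → (∀ k → (W η ∩ₙ W ν) k → k < ℓ) →
    FiniteSeqSet (U η ∩ₛ U ν)
  × (∀ ℓ' → ℓ < ℓ' → (W η ℓ' ⊎ W ν ℓ') → ∀ ρ → (U η ∩ₛ U ν) ρ → length ρ < ℓ')
  × (∀ ρ → ℓ ≤ length ρ → ¬ ((U η ∩ₛ U ν) (ρ ⌢ false) × (U η ∩ₛ U ν) (ρ ⌢ true)))

-- ℓ < sup(W_η ∩ W_ν) is read as: some element of W_η ∩ W_ν exceeds ℓ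
ClauseFc : Subℕ → (Seqω → Subℕ) → (Seqω → SubSeq) → Seqω → Seqω → Set
ClauseFc W* W U η ν = ∀ ℓ → W* ℓ → (∃ λ k → (W η ∩ₙ W ν) k × ℓ < k) →
  ∀ ρ → length ρ ≤ ℓ → (U η ρ → U ν ρ) × (U ν ρ → U η ρ)

{-# OPTIONS --safe #-}
module Submission where

-- List the finite 0-1 sequences shortest first and use the k-th one as the label
-- of level k. The levels labelled 0^(j+1) form W(*), those labelled 1⌢s with
-- s ⊴ η form W_η, and U_η is the tree that splits exactly at the levels of W_η,
-- continues with η(j) at the star level 0^(j+1) and with 0 elsewhere. Two trees U_η, U_ν thus share
-- no node beyond the first star level recording a difference between η and ν,
-- while W_η ∩ W_ν consists of the codes of the common initial segments of η and ν.
-- Since labels never get shorter along the list and every length starts with its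
-- all-zero label, each clause reduces to comparing label lengths.

open import Defs
open import Data.Bool using (Bool; true; false; not; T; if_then_else_)
open import Data.Bool.ListAction using (all)
open import Data.Empty using (⊥)
open import Data.List using ([]; _∷_; _++_; [_]; length; replicate; map; applyUpTo; upTo)
open import Data.List.Properties using (length-replicate; length-++; length-applyUpTo; ++-assoc)
open import Data.List.Membership.Propositional using (_∈_)
open import Data.List.Membership.Propositional.Properties using (∈-map⁺; ∈-upTo⁺)
open import Data.Nat using (ℕ; zero; suc; pred; _+_; _∸_; _≤_; _<_; z≤n; s≤s; s≤s⁻¹; s<s⁻¹; _<?_)
open import Data.Nat.Properties
open import Data.Product using (Σ; _×_; _,_; proj₁; proj₂)
open import Data.Sum using (_⊎_; inj₁; inj₂; [_,_]′; map₂)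
open import Data.Unit using (⊤; tt)
open import Function using (_∘_; id)
open import Relation.Nullary using (¬_; Dec; yes; no; contradiction)
open import Relation.Nullary.Decidable using (T?)
open import Relation.Binary.PropositionalEquality
  using (_≡_; _≢_; refl; sym; trans; cong; subst; subst₂; module ≡-Reasoning)

-- word k is k + 1 in binary, least significant bit first, with the final 1 dropped.
next : Seq → Seq
next []          = false ∷ []
next (false ∷ x) = true ∷ x
next (true ∷ x)  = false ∷ next x

word : ℕ → Seq
word zero    = []
word (suc k) = next (word k)

index : Seq → ℕ
index []          = 0
index (false ∷ x) = suc (index x + index x)
index (true ∷ x)  = suc (suc (index x + index x))

length-next-≥ : ∀ x → length x ≤ length (next x)
length-next-≥ []          = z≤n
length-next-≥ (false ∷ x) = ≤-refl
length-next-≥ (true ∷ x)  = s≤s (length-next-≥ x)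

length-next-≤ : ∀ x → length (next x) ≤ suc (length x)
length-next-≤ []          = ≤-refl
length-next-≤ (false ∷ x) = n≤1+n _
length-next-≤ (true ∷ x)  = s≤s (length-next-≤ x)

length-next-allFalse : ∀ x → T (all not (next x)) → length (next x) ≡ suc (length x)
length-next-allFalse []          _  = refl
length-next-allFalse (false ∷ x) ()
length-next-allFalse (true ∷ x)  t  = cong suc (length-next-allFalse x t)

length-word≤ : ∀ k → length (word k) ≤ k
length-word≤ zero    = z≤n
length-word≤ (suc k) = ≤-trans (length-next-≤ (word k)) (s≤s (length-word≤ k))

length-word-+ : ∀ i d → length (word i) ≤ length (word (d + i))
length-word-+ i zero    = ≤-refl
length-word-+ i (suc d) = ≤-trans (length-word-+ i d) (length-next-≥ (word (d + i)))

length-word-mono : ∀ {i j} → i ≤ j → length (word i) ≤ length (word j)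
length-word-mono {i} {j} i≤j =
  subst (λ k → length (word i) ≤ length (word k)) (m∸n+n≡m i≤j) (length-word-+ i (j ∸ i))

length-word-<⇒< : ∀ {i j} → length (word i) < length (word j) → i < j
length-word-<⇒< {i} {j} lt with i <? j
... | yes i<j = i<j
... | no  i≮j = contradiction (length-word-mono (≮⇒≥ i≮j)) (<⇒≱ lt)

allFalse-first : ∀ {i j} → T (all not (word j)) → i < j → length (word i) < length (word j)
allFalse-first {i} {suc j} t (s≤s i≤j) =
  subst (length (word i) <_) (sym (length-next-allFalse (word j) t)) (s≤s (length-word-mono i≤j))

word-2n+1 : ∀ n → word (suc (n + n)) ≡ false ∷ word n
word-2n+1 zero = refl
word-2n+1 (suc n) rewrite +-suc n n = cong (next ∘ next) (word-2n+1 n)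

word-2n+2 : ∀ n → word (suc (suc (n + n))) ≡ true ∷ word n
word-2n+2 n = cong next (word-2n+1 n)

word-index : ∀ x → word (index x) ≡ x
word-index []          = refl
word-index (false ∷ x) = trans (word-2n+1 (index x)) (cong (false ∷_) (word-index x))
word-index (true ∷ x)  = trans (word-2n+2 (index x)) (cong (true ∷_) (word-index x))

_⊴ω_ : Seq → Seqω → Set
[]      ⊴ω η = ⊤
(c ∷ s) ⊴ω η = c ≡ η 0 × s ⊴ω (η ∘ suc)

AgreeBelow : ℕ → Seqω → Seqω → Set
AgreeBelow n η ν = ∀ {i} → i < n → η i ≡ ν i

AgreeBelow-sym : ∀ {n η ν} → AgreeBelow n η ν → AgreeBelow n ν η
AgreeBelow-sym agree = sym ∘ agree

AgreeBelow-≤ : ∀ {m n η ν} → m ≤ n → AgreeBelow n η ν → AgreeBelow m η ν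
AgreeBelow-≤ m≤n agree i<m = agree (<-≤-trans i<m m≤n)

⊴ω-agree : ∀ {η ν} s → s ⊴ω η → s ⊴ω ν → AgreeBelow (length s) η ν
⊴ω-agree []      _           _                   ()
⊴ω-agree (c ∷ s) (c≡η0 , _)  (c≡ν0 , _)  {zero}  _        = trans (sym c≡η0) c≡ν0
⊴ω-agree (c ∷ s) (_ , s⊴η)   (_ , s⊴ν)   {suc i} (s≤s i<) = ⊴ω-agree s s⊴η s⊴ν i<

⊴ω-transfer : ∀ {η ν} s → AgreeBelow (length s) η ν → s ⊴ω η → s ⊴ω ν
⊴ω-transfer []      _     _            = tt
⊴ω-transfer (c ∷ s) agree (c≡η0 , s⊴η) =
  trans c≡η0 (agree (s≤s z≤n)) , ⊴ω-transfer s (agree ∘ s≤s) s⊴η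

applyUpTo-⊴ω : ∀ η n → applyUpTo η n ⊴ω η
applyUpTo-⊴ω η zero    = tt
applyUpTo-⊴ω η (suc n) = refl , applyUpTo-⊴ω (η ∘ suc) n

StarWord : Seq → Set
StarWord (false ∷ x) = T (all not x)
StarWord _           = ⊥

CodeWord : Seqω → Seq → Set
CodeWord η (true ∷ s) = s ⊴ω η
CodeWord η _          = ⊥

forcedBit : Seqω → Seq → Bool
forcedBit η (false ∷ x) = if all not x then η (length x) else false
forcedBit η _           = false

starWord? : ∀ x → Dec (StarWord x)
starWord? []          = no λ ()
starWord? (false ∷ x) = T? (all not x)
starWord? (true ∷ x)  = no λ ()

starWord-allFalse : ∀ x → StarWord x → T (all not x)
starWord-allFalse (false ∷ x) t = t
starWord-allFalse []          ()
starWord-allFalse (true ∷ x)  ()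

starWord-length : ∀ x → StarWord x → length x ≡ suc (pred (length x))
starWord-length (false ∷ x) _ = refl
starWord-length []          ()
starWord-length (true ∷ x)  ()

starWord-codeWord-disjoint : ∀ {η} x → StarWord x → CodeWord η x → ⊥
starWord-codeWord-disjoint []          ()
starWord-codeWord-disjoint (false ∷ x) _ ()
starWord-codeWord-disjoint (true ∷ x)  ()

codeWord-transfer : ∀ {η ν} x → AgreeBelow (pred (length x)) η ν → CodeWord η x → CodeWord ν x
codeWord-transfer []          _ ()
codeWord-transfer (false ∷ x) _ ()
codeWord-transfer (true ∷ s)    = ⊴ω-transfer s

codeWord-agree : ∀ {η ν} x → CodeWord η x → CodeWord ν x → AgreeBelow (pred (length x)) η ν
codeWord-agree []          ()
codeWord-agree (false ∷ x) ()
codeWord-agree (true ∷ s)  = ⊴ω-agree s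

forcedBit-star : ∀ {η} x → StarWord x → forcedBit η x ≡ η (pred (length x))
forcedBit-star []          ()
forcedBit-star (false ∷ x) t with all not x
... | true = refl
forcedBit-star (true ∷ x)  ()

forcedBit-nonstar : ∀ {η} x → ¬ StarWord x → forcedBit η x ≡ false
forcedBit-nonstar []          _       = refl
forcedBit-nonstar (false ∷ x) nonstar with all not x
... | true  = contradiction _ nonstar
... | false = refl
forcedBit-nonstar (true ∷ x)  _       = refl

W* : Subℕ
W* k = StarWord (word k)

W : Seqω → Subℕ
W η k = CodeWord η (word k)

forced : Seqω → ℕ → Bool
forced η k = forcedBit η (word k)

depth : ℕ → ℕ
depth k = pred (length (word k))

W*? : ∀ k → Dec (W* k)
W*? k = starWord? (word k)

W*-W-disjoint : ∀ {η} k → W* k → W η k → ⊥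
W*-W-disjoint k = starWord-codeWord-disjoint (word k)

forced-star : ∀ {η} k → W* k → forced η k ≡ η (depth k)
forced-star k = forcedBit-star (word k)

forced-nonstar : ∀ {η} k → ¬ W* k → forced η k ≡ false
forced-nonstar k = forcedBit-nonstar (word k)

W-transfer : ∀ {η ν} k → AgreeBelow (depth k) η ν → W η k → W ν k
W-transfer k = codeWord-transfer (word k)

W-agree : ∀ {η ν} k → W η k → W ν k → AgreeBelow (depth k) η ν
W-agree k = codeWord-agree (word k)

depth-mono : ∀ {i j} → i ≤ j → depth i ≤ depth j
depth-mono = pred-mono-≤ ∘ length-word-mono

depth-<⇒< : ∀ {i j} → depth i < depth j → i < j
depth-<⇒< = length-word-<⇒< ∘ pred-cancel-<

depth≤ : ∀ k → depth k ≤ k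
depth≤ k = ≤-trans pred[n]≤n (length-word≤ k)

star-depth-< : ∀ {q ℓ} → W* q → W* ℓ → q < ℓ → depth q < depth ℓ
star-depth-< {q} {ℓ} starq starℓ q<ℓ =
  s<s⁻¹ (subst₂ _<_ (starWord-length (word q) starq) (starWord-length (word ℓ) starℓ)
                    (allFalse-first (starWord-allFalse (word ℓ) starℓ) q<ℓ))

starLevel : ℕ → ℕ
starLevel i = index (false ∷ replicate i false)

codeLevel : Seq → ℕ
codeLevel s = index (true ∷ s)

all-not-replicate : ∀ i → T (all not (replicate i false))
all-not-replicate zero    = tt
all-not-replicate (suc i) = all-not-replicate i

W*-starLevel : ∀ i → W* (starLevel i)
W*-starLevel i = subst StarWord (sym (word-index (false ∷ replicate i false))) (all-not-replicate i)

length-word-starLevel : ∀ i → length (word (starLevel i)) ≡ suc i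
length-word-starLevel i =
  trans (cong length (word-index (false ∷ replicate i false))) (cong suc (length-replicate i))

depth-starLevel : ∀ i → depth (starLevel i) ≡ i
depth-starLevel i = cong pred (length-word-starLevel i)

forced-starLevel : ∀ {η} i → forced η (starLevel i) ≡ η i
forced-starLevel {η} i = trans (forced-star (starLevel i) (W*-starLevel i)) (cong η (depth-starLevel i))

starLevel-≤ : ∀ {i ℓ} → W* ℓ → i ≤ depth ℓ → starLevel i ≤ ℓ
starLevel-≤ {i} {ℓ} starℓ i≤depth = ≮⇒≥ λ ℓ<starLevel →
  <⇒≱ (subst (depth ℓ <_) (depth-starLevel i) (star-depth-< starℓ (W*-starLevel i) ℓ<starLevel)) i≤depth

W-codeLevel : ∀ {η s} → s ⊴ω η → W η (codeLevel s)
W-codeLevel {η} {s} = subst (CodeWord η) (sym (word-index (true ∷ s)))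

depth-codeLevel : ∀ s → depth (codeLevel s) ≡ length s
depth-codeLevel s = cong (pred ∘ length) (word-index (true ∷ s))

W*-infinite : Infinite W*
W*-infinite n = starLevel n , ≤-trans (≤-reflexive (sym (depth-starLevel n))) (depth≤ _) , W*-starLevel n

W-infinite : ∀ η → Infinite (W η)
W-infinite η n = codeLevel s , ≤-trans (≤-reflexive n≡depth) (depth≤ _) , W-codeLevel (applyUpTo-⊴ω η n)
  where
  s = applyUpTo η n
  n≡depth : n ≡ depth (codeLevel s)
  n≡depth = sym (trans (depth-codeLevel s) (length-applyUpTo η n))

Allowed : Seqω → ℕ → Bool → Set
Allowed η k c = c ≡ forced η k ⊎ W η k

Follows : Seqω → ℕ → Seq → Set
Follows η k []      = ⊤
Follows η k (c ∷ ρ) = Allowed η k c × Follows η (suc k) ρ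

U : Seqω → SubSeq
U η = Follows η 0

Follows-++⁻ : ∀ {η} k p {q} → Follows η k (p ++ q) → Follows η k p × Follows η (k + length p) q
Follows-++⁻ {η} k []      {q} follows = tt , subst (λ m → Follows η m q) (sym (+-identityʳ k)) follows
Follows-++⁻ {η} k (c ∷ p) {q} (allowed , follows) with Follows-++⁻ (suc k) p follows
... | followsp , followsq =
  (allowed , followsp) , subst (λ m → Follows η m q) (sym (+-suc k (length p))) followsq

Follows-++⁺ : ∀ {η} k p {q} → Follows η k p → Follows η (k + length p) q → Follows η k (p ++ q)
Follows-++⁺ {η} k []      {q} _ follows = subst (λ m → Follows η m q) (+-identityʳ k) follows
Follows-++⁺ {η} k (c ∷ p) {q} (allowed , followsp) followsq =
  allowed , Follows-++⁺ (suc k) p followsp (subst (λ m → Follows η m q) (+-suc k (length p)) followsq)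

Follows-mono : ∀ {η ν} k ρ → (∀ {q c} → q < k + length ρ → Allowed η q c → Allowed ν q c) →
               Follows η k ρ → Follows ν k ρ
Follows-mono k []      _  _                  = tt
Follows-mono k (c ∷ ρ) ⊆ (allowed , follows) =
  ⊆ (m<m+n k (s≤s z≤n)) allowed ,
  Follows-mono (suc k) ρ (λ {q} q< → ⊆ (subst (q <_) (sym (+-suc k (length ρ))) q<)) follows

forcedRun : Seqω → ℕ → ℕ → Seq
forcedRun η k zero    = []
forcedRun η k (suc n) = forced η k ∷ forcedRun η (suc k) n

Follows-forcedRun : ∀ {η} k n b → W η (k + n) → Follows η k (forcedRun η k n ++ [ b ])
Follows-forcedRun {η} k zero    b w = inj₂ (subst (W η) (+-identityʳ k) w) , tt
Follows-forcedRun {η} k (suc n) b w =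
  inj₁ refl , Follows-forcedRun (suc k) n b (subst (W η) (+-suc k n) w)

allowed-star : ∀ {η c} k → W* k → Allowed η k c → c ≡ forced η k
allowed-star k _     (inj₁ c≡forced) = c≡forced
allowed-star k stark (inj₂ w)        = contradiction w (W*-W-disjoint k stark)

allowed-distinct : ∀ {η ν a b} k → Allowed η k a → Allowed ν k b → a ≢ b →
                   forced η k ≡ forced ν k → W η k ⊎ W ν k
allowed-distinct k (inj₁ a≡) (inj₁ b≡) a≢b forced≡ =
  contradiction (trans a≡ (trans forced≡ (sym b≡))) a≢b
allowed-distinct k (inj₂ w)  _         _   _       = inj₁ w
allowed-distinct k (inj₁ _)  (inj₂ w)  _   _       = inj₂ w

Follows-common-star : ∀ {η ν q} k p → Follows η k p → Follows ν k p →
                      W* q → k ≤ q → q < k + length p → forced η q ≡ forced ν q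
Follows-common-star {q = q} k [] _ _ _ k≤q q< =
  contradiction (subst (q <_) (+-identityʳ k) q<) (≤⇒≯ k≤q)
Follows-common-star {q = q} k (c ∷ p) (allowedη , followsη) (allowedν , followsν) starq k≤q q<
  with m≤n⇒m<n∨m≡n k≤q
... | inj₂ refl = trans (sym (allowed-star k starq allowedη)) (allowed-star k starq allowedν)
... | inj₁ k<q  =
  Follows-common-star (suc k) p followsη followsν starq k<q (subst (q <_) (+-suc k (length p)) q<)

common-prefix-stars : ∀ {η ν i} p → U η p → U ν p → starLevel i < length p → η i ≡ ν i
common-prefix-stars {η} {ν} {i} p uη uν lt = begin
  η i                    ≡⟨ forced-starLevel i ⟨
  forced η (starLevel i) ≡⟨ Follows-common-star 0 p uη uν (W*-starLevel i) z≤n lt ⟩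
  forced ν (starLevel i) ≡⟨ forced-starLevel i ⟩
  ν i                    ∎
  where open ≡-Reasoning

record Diverge (ρ ν : Seq) : Set where
  constructor diverge
  field
    stem    : Seq
    a b     : Bool
    ρ' ν'   : Seq
    ρ≡      : ρ ≡ stem ++ a ∷ ρ'
    ν≡      : ν ≡ stem ++ b ∷ ν'
    a≢b     : a ≢ b
    lgMeet≡ : lgMeet ρ ν ≡ length stem

diverge-∷ : ∀ c {ρ ν} → Diverge ρ ν → Diverge (c ∷ ρ) (c ∷ ν)
diverge-∷ c (diverge p a b ρ' ν' refl refl a≢b meet) =
  diverge (c ∷ p) a b ρ' ν' refl refl a≢b (trans (lgMeet-∷ c) (cong suc meet))
  where
  lgMeet-∷ : ∀ c {ρ ν} → lgMeet (c ∷ ρ) (c ∷ ν) ≡ suc (lgMeet ρ ν)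
  lgMeet-∷ false = refl
  lgMeet-∷ true  = refl

compare-∷ : ∀ c {ρ ν} → (ρ ⊴ ν) ⊎ (ν ◁ ρ) ⊎ Diverge ρ ν →
            ((c ∷ ρ) ⊴ (c ∷ ν)) ⊎ ((c ∷ ν) ◁ (c ∷ ρ)) ⊎ Diverge (c ∷ ρ) (c ∷ ν)
compare-∷ c (inj₁ (τ , refl))               = inj₁ (τ , refl)
compare-∷ c (inj₂ (inj₁ ((τ , refl) , lt))) = inj₂ (inj₁ ((τ , refl) , s≤s lt))
compare-∷ c (inj₂ (inj₂ d))                 = inj₂ (inj₂ (diverge-∷ c d))

compare : ∀ ρ ν → (ρ ⊴ ν) ⊎ (ν ◁ ρ) ⊎ Diverge ρ ν
compare []          ν           = inj₁ (ν , refl)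
compare (a ∷ ρ)     []          = inj₂ (inj₁ (((a ∷ ρ) , refl) , s≤s z≤n))
compare (false ∷ ρ) (false ∷ ν) = compare-∷ false (compare ρ ν)
compare (true ∷ ρ)  (true ∷ ν)  = compare-∷ true (compare ρ ν)
compare (false ∷ ρ) (true ∷ ν)  = inj₂ (inj₂ (diverge [] false true ρ ν refl refl (λ ()) refl))
compare (true ∷ ρ)  (false ∷ ν) = inj₂ (inj₂ (diverge [] true false ρ ν refl refl (λ ()) refl))

⊴-length-≡ : ∀ {ρ ν} → ρ ⊴ ν → length ρ ≡ length ν → ρ ≡ ν
⊴-length-≡ {[]}    ([]    , refl) _ = refl
⊴-length-≡ {[]}    (_ ∷ _ , refl) ()
⊴-length-≡ {c ∷ ρ} (τ     , refl) |ρ|≡ = cong (c ∷_) (⊴-length-≡ (τ , refl) (suc-injective |ρ|≡))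

U-branch : ∀ {η} p {a ρ'} → U η (p ++ a ∷ ρ') → U η p × Allowed η (length p) a
U-branch p u with Follows-++⁻ 0 p u
... | up , (allowed , _) = up , allowed

U-perfect : ∀ η → PerfectTree (U η)
U-perfect η = prefix-closed , tt , splits-above
  where
  prefix-closed : ∀ ρ ν → U η ν → ρ ⊴ ν → U η ρ
  prefix-closed ρ _ u (τ , refl) = proj₁ (Follows-++⁻ 0 ρ u)
  splits-above : ∀ ρ → U η ρ → Σ Seq λ ν → ρ ⊴ ν × U η (ν ⌢ false) × U η (ν ⌢ true)
  splits-above ρ u with W-infinite η (length ρ)
  ... | m , |ρ|≤m , wm = ρ ++ run , (run , refl) , branch false , branch true
    where
    run = forcedRun η (length ρ) (m ∸ length ρ)
    branch : ∀ b → U η ((ρ ++ run) ⌢ b)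
    branch b = subst (U η) (sym (++-assoc ρ run [ b ]))
      (Follows-++⁺ 0 ρ u (Follows-forcedRun (length ρ) (m ∸ length ρ) b
                                            (subst (W η) (sym (m+[n∸m]≡n |ρ|≤m)) wm)))

clauseC : ∀ η → ClauseC W U η
clauseC η ρ ν uρ uν ρ≢ν |ρ|≡|ν| with compare ρ ν
... | inj₁ ρ⊴ν = contradiction (⊴-length-≡ ρ⊴ν |ρ|≡|ν|) ρ≢ν
... | inj₂ (inj₁ (_ , |ν|<|ρ|)) = contradiction (sym |ρ|≡|ν|) (<⇒≢ |ν|<|ρ|)
... | inj₂ (inj₂ (diverge p a b ρ' ν' refl refl a≢b meet)) =
  subst (W η) (sym meet) ([ id , id ]′ (allowed-distinct (length p) allowedρ allowedν a≢b refl))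
  where
  allowedρ = proj₂ (U-branch p uρ)
  allowedν = proj₂ (U-branch p uν)

common-prefix-agree : ∀ {η ν} p → U η p → U ν p → AgreeBelow (depth (length p)) η ν
common-prefix-agree p uη uν {i} i<depth =
  common-prefix-stars p uη uν (depth-<⇒< (subst (_< depth (length p)) (sym (depth-starLevel i)) i<depth))

diverge-cases : ∀ {η₁ η₂ a b ρ' ν'} p → U η₁ (p ++ a ∷ ρ') → U η₂ (p ++ b ∷ ν') → a ≢ b →
    (W η₁ (length p) × W η₂ (length p))
  ⊎ (W* (length p) × (∀ ℓ → ℓ < length p → (W η₁ ℓ → W η₂ ℓ) × (W η₂ ℓ → W η₁ ℓ)))
diverge-cases {η₁} {η₂} p u₁ u₂ a≢b with U-branch p u₁ | U-branch p u₂ | W*? (length p)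
... | up₁ , _ | up₂ , _ | yes star = inj₂ (star , λ ℓ ℓ<|p| →
  let agreeℓ = AgreeBelow-≤ (depth-mono (<⇒≤ ℓ<|p|)) (common-prefix-agree p up₁ up₂)
  in  W-transfer ℓ agreeℓ , W-transfer ℓ (AgreeBelow-sym agreeℓ))
... | up₁ , allowed₁ | up₂ , allowed₂ | no nonstar =
  inj₁ ([ to-both , from-both ]′ (allowed-distinct K allowed₁ allowed₂ a≢b forced≡))
  where
  K = length p
  agree : AgreeBelow (depth K) η₁ η₂
  agree = common-prefix-agree p up₁ up₂
  forced≡ : forced η₁ K ≡ forced η₂ K
  forced≡ = trans (forced-nonstar K nonstar) (sym (forced-nonstar K nonstar))
  to-both : W η₁ K → W η₁ K × W η₂ K
  to-both w = w , W-transfer K agree w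
  from-both : W η₂ K → W η₁ K × W η₂ K
  from-both w = W-transfer K (AgreeBelow-sym agree) w , w

clauseD : ClauseD W* W U
clauseD η₁ η₂ _ ρ ν u₁ u₂ with compare ρ ν
... | inj₁ ρ⊴ν        = inj₂ (inj₂ (inj₁ ρ⊴ν))
... | inj₂ (inj₁ ν◁ρ) = inj₂ (inj₂ (inj₂ ν◁ρ))
... | inj₂ (inj₂ (diverge p a b ρ' ν' refl refl a≢b meet)) rewrite meet =
  map₂ inj₁ (diverge-cases p u₁ u₂ a≢b)

W-initial : ∀ {η ν m k} → m < k → W η m → W η k → W ν k → W ν m
W-initial {m = m} {k} m<k wm wk wk' =
  W-transfer m (AgreeBelow-≤ (depth-mono (<⇒≤ m<k)) (W-agree k wk wk')) wm

clauseFa : ∀ η ν → η ≠ω ν → ClauseFa W η ν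
clauseFa η ν (n , ηn≢νn) =
  (starLevel (suc n) , below-starLevel) ,
  ((λ _ → proj₁) , λ m k wm m<k (wk , wk') → wm , W-initial m<k wm wk wk') ,
  ((λ _ → proj₂) , λ m k wm m<k (wk , wk') → W-initial m<k wm wk' wk , wm)
  where
  below-starLevel : ∀ k → (W η ∩ₙ W ν) k → k < starLevel (suc n)
  below-starLevel k (wk , wk') =
    depth-<⇒< (subst (depth k <_) (sym (depth-starLevel (suc n))) (s≤s depth≤n))
    where
    depth≤n : depth k ≤ n
    depth≤n = ≮⇒≥ (ηn≢νn ∘ W-agree k wk wk')

∈-words-≤ : ∀ {ρ n} → length ρ ≤ n → ρ ∈ map word (upTo (starLevel n))
∈-words-≤ {ρ} {n} |ρ|≤n =
  subst (_∈ map word (upTo (starLevel n))) (word-index ρ) (∈-map⁺ word (∈-upTo⁺ index<))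
  where
  index< : index ρ < starLevel n
  index< = length-word-<⇒<
    (subst₂ _<_ (sym (cong length (word-index ρ))) (sym (length-word-starLevel n)) (s≤s |ρ|≤n))

-- A common node above a star level ℓ makes η and ν agree up to depth ℓ, so the
-- code of η ↾ (depth ℓ + 1) is a common level above ℓ.
common-length-≤ : ∀ {η ν ℓ ρ} → W* ℓ → (∀ k → (W η ∩ₙ W ν) k → k < ℓ) → U η ρ → U ν ρ → length ρ ≤ ℓ
common-length-≤ {η} {ν} {ℓ} {ρ} starℓ common<ℓ uη uν = ≮⇒≥ λ ℓ<|ρ| →
  <-asym (common<ℓ c (W-codeLevel s⊴η , W-codeLevel (⊴ω-transfer s (agree ℓ<|ρ|) s⊴η))) ℓ<c
  where
  d = depth ℓ
  s = applyUpTo η (suc d)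
  s⊴η = applyUpTo-⊴ω η (suc d)
  c = codeLevel s
  depth-c : depth c ≡ suc d
  depth-c = trans (depth-codeLevel s) (length-applyUpTo η (suc d))
  ℓ<c : ℓ < c
  ℓ<c = depth-<⇒< (subst (d <_) (sym depth-c) ≤-refl)
  agree : ℓ < length ρ → AgreeBelow (length s) η ν
  agree ℓ<|ρ| {i} i<|s| = common-prefix-stars ρ uη uν
    (≤-<-trans (starLevel-≤ starℓ (s≤s⁻¹ (subst (i <_) (length-applyUpTo η (suc d)) i<|s|))) ℓ<|ρ|)

clauseFb : ∀ η ν → ClauseFb W* W U η ν
clauseFb η ν ℓ starℓ common<ℓ =
  (map word (upTo (starLevel ℓ)) , λ ρ u → ∈-words-≤ (short u)) ,
  (λ ℓ' ℓ<ℓ' _ ρ u → ≤-<-trans (short u) ℓ<ℓ') ,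
  λ ρ ℓ≤|ρ| (u₀ , _) →
    m+1+n≰m (length ρ) (≤-trans (subst (_≤ ℓ) (length-++ ρ) (short u₀)) ℓ≤|ρ|)
  where
  short : ∀ {ρ} → (U η ∩ₛ U ν) ρ → length ρ ≤ ℓ
  short (uη , uν) = common-length-≤ starℓ common<ℓ uη uν

forced-below-star : ∀ {η ν ℓ q} → W* ℓ → AgreeBelow (depth ℓ) η ν → q < ℓ →
                    forced η q ≡ forced ν q
forced-below-star {q = q} starℓ agree q<ℓ with W*? q
... | yes starq  =
  trans (forced-star q starq) (trans (agree (star-depth-< starq starℓ q<ℓ)) (sym (forced-star q starq)))
... | no nonstar = trans (forced-nonstar q nonstar) (sym (forced-nonstar q nonstar))

allowed-below-star : ∀ {η ν ℓ q c} → W* ℓ → AgreeBelow (depth ℓ) η ν → q < ℓ →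
                     Allowed η q c → Allowed ν q c
allowed-below-star starℓ agree q<ℓ (inj₁ c≡) =
  inj₁ (trans c≡ (forced-below-star starℓ agree q<ℓ))
allowed-below-star {q = q} starℓ agree q<ℓ (inj₂ w) =
  inj₂ (W-transfer q (AgreeBelow-≤ (depth-mono (<⇒≤ q<ℓ)) agree) w)

clauseFc : ∀ η ν → ClauseFc W* W U η ν
clauseFc η ν ℓ starℓ (k , (wk , wk') , ℓ<k) ρ |ρ|≤ℓ =
  Follows-mono 0 ρ (λ q< → allowed-below-star starℓ agree (<-≤-trans q< |ρ|≤ℓ)) ,
  Follows-mono 0 ρ (λ q< → allowed-below-star starℓ (AgreeBelow-sym agree) (<-≤-trans q< |ρ|≤ℓ))
  where
  agree : AgreeBelow (depth ℓ) η ν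
  agree = AgreeBelow-≤ (depth-mono (<⇒≤ ℓ<k)) (W-agree k wk wk')

fact4p9 : Σ Subℕ λ W* → Σ (Seqω → Subℕ) λ W → Σ (Seqω → SubSeq) λ U →
            (∀ η → ClauseA W* W η × PerfectTree (U η) × ClauseC W U η × ClauseE W* W η)
            × ClauseD W* W U
            × (∀ η ν → η ≠ω ν → ClauseFa W η ν × ClauseFb W* W U η ν × ClauseFc W* W U η ν)
fact4p9 = W* , W , U ,
  (λ η → (W*-infinite , W-infinite η) , U-perfect η , clauseC η , W*-W-disjoint) ,
  clauseD ,
  (λ η ν η≠ν → clauseFa η ν η≠ν , clauseFb η ν , clauseFc η ν)
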